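{- Let $\mathcal{T}$ be a progressing timed MSR system (PTS), $\mathcal{S}_0$ an initial configuration and $\mathcal{CS}$ a critical configuration specification, with properties taken with respect to $\mathcal{S}_0$, $\mathcal{CS}$ and lazy time sampling. Then $\mathcal{T}$ satisfies the $L$ property if and only if $\mathcal{T}$ satisfies the $V$ property.
   Context: A fact is $P(u_1,\dots,u_n)$ over a finite first-order typed alphabet; a timestamped fact is $F@t$, $t\in\mathbb{N}$. A configuration is a finite multiset of ground timestamped facts with exactly one fact $Time@t$ (global time $t$). The $Tick$ rule is $Time@T\to Time@(T+1)$. An instantaneous rule has the form $Time@T, W_1@T_1,\dots,W_p@T_p, F_1@T_1',\dots,F_n@T_n' \mid \mathcal{C} \to \exists \vec X.[Time@T, W_1@T_1,\dots,W_p@T_p, Q_1@(T+d_1),\dots,Q_m@(T+d_m)]$ with $d_i\in\mathbb{N}$, $\mathcal{C}$ a set of constraints $T_a>T_b\pm d$ or $T_a=T_b\pm d$ over the precondition's time variables, $\vec X$ fresh values; the facts $F_i@T_i'$ are consumed and the $Q_i@(T+d_i)$ created. A rule $\mathcal{W}\mid\mathcal{C}\to\exists\vec X.\mathcal{W}'$ applies to $\mathcal{S}$ if for a ground substitution $\sigma$, $\mathcal{W}\sigma\subseteq\mathcal{S}$ and $\mathcal{C}\sigma$ holds, giving $((\mathcal{S}\setminus\mathcal{W})\cup\mathcal{W}')\sigma$. A timed MSR system is a set of instantaneous rules plus $Tick$. It is balanced if every instantaneous rule has $m=n$. It is a progressing timed system (PTS) if it is balanced and every instantaneous rule (i) has $d_i\ge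 1$ for at least one $i$ and (ii) has constraint set $\mathcal{C}$ containing $T\ge T_i'$ for every consumed fact $F_i@T_i'$. A trace is a finite or infinite sequence of single rule applications; an infinite time trace is one in which the global time exceeds every $n\in\mathbb{N}$. A critical configuration specification is a set of pairs $\langle\mathcal{S}_j,\mathcal{C}_j\rangle$, $\mathcal{S}_j$ a finite multiset of facts $F@T$ with time variables, $\mathcal{C}_j$ constraints on them; $\mathcal{S}$ is critical if some $\mathcal{S}_j\sigma\subseteq\mathcal{S}$ with $\mathcal{C}_j\sigma$ true for a ground substitution $\sigma$ (nonces renamed). A trace is compliant if it contains no critical configuration. A trace uses lazy time sampling (l.t.s.) if whenever $\mathcal{S}_i\to_{Tick}\mathcal{S}_{i+1}$ occurs, no instantaneous rule instance is applicable to $\mathcal{S}_i$. $Z$ property: there is a compliant infinite time trace from $\mathcal{S}_0$ using l.t.s. A point-of-no-return is a non-critical configuration $\mathcal{S}$ such that every infinite trace starting from $\mathcal{S}$ using l.t.s. is not compliant. $V$ property: $Z$ holds and no configuration reachable from $\mathcal{S}_0$ by a compliant trace using l.t.s. is a point-of-no-return. $L$ property: $Z$ holds and for every configuration $\mathcal{S}$ reachable from $\mathcal{S}_0$ by a compliant trace using l.t.s., there is a compliant infinite time trace from $\mathcal{S}$ using l.t.s. -}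

module Defs where

open import Level using (0ℓ)
open import Data.Nat using (ℕ; suc; _+_; _<_; _≤_)
open import Data.Fin using (Fin)
open import Data.Empty using (⊥)
open import Data.Sum using (_⊎_; inj₁; inj₂)
open import Data.Product using (Σ; ∃; ∃-syntax; _×_; _,_; proj₁; proj₂)
open import Data.List using (List; []; _∷_; _++_; map; length)
open import Data.List.Relation.Unary.All using (All)
open import Data.List.Relation.Unary.Any using (Any)
open import Data.List.Membership.Propositional using (_∈_)
open import Data.List.Relation.Binary.Permutation.Propositional using (_↭_)
open import Relation.Binary.PropositionalEquality using (_≡_)
open import Relation.Nullary using (¬_)
open import Function.Bundles using (_↔_)
open import Function.Definitions using (Injective)

-- Sorts, predicate symbols (other than the special Time predicate) and
-- function symbols (constants are 0-ary function symbols) are finite.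

record Alphabet : Set₁ where
  field
    Sort      : Set
    Pred      : Set
    Fun       : Set
    predArity : Pred → List Sort
    funArity  : Fun → List Sort
    funSort   : Fun → Sort
    sortFinite : ∃[ n ] (Fin n ↔ Sort)
    predFinite : ∃[ n ] (Fin n ↔ Pred)
    funFinite  : ∃[ n ] (Fin n ↔ Fun)

module MSR (𝒜 : Alphabet) where
  open Alphabet 𝒜

  -- Terms over a set X of variable names (a variable name occurring at
  -- sort s denotes the variable of sort s with that name).

  mutual
    data Term (X : Set) : Sort → Set where
      var   : ∀ {s} → X → Term X s
      nonce : ∀ {s} → ℕ → Term X s
      app   : (f : Fun) → Args X (funArity f) → Term X (funSort f)

    data Args (X : Set) : List Sort → Set where
      []  : Args X []
      _∷_ : ∀ {s ss} → Term X s → Args X ss → Args X (s ∷ ss)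

  mutual
    subst : ∀ {X Y s} → ((s : Sort) → X → Term Y s) → (ℕ → ℕ) →
            Term X s → Term Y s
    subst {s = s} σ ν (var x) = σ s x
    subst σ ν (nonce n) = nonce (ν n)
    subst σ ν (app f as) = app f (substArgs σ ν as)

    substArgs : ∀ {X Y ss} → ((s : Sort) → X → Term Y s) → (ℕ → ℕ) →
                Args X ss → Args Y ss
    substArgs σ ν [] = []
    substArgs σ ν (t ∷ as) = subst σ ν t ∷ substArgs σ ν as

  mutual
    NonceIn : ∀ {X s} → ℕ → Term X s → Set
    NonceIn k (var x) = ⊥
    NonceIn k (nonce n) = k ≡ n
    NonceIn k (app f as) = NonceInArgs k as

    NonceInArgs : ∀ {X ss} → ℕ → Args X ss → Set
    NonceInArgs k [] = ⊥
    NonceInArgs k (t ∷ as) = NonceIn k t ⊎ NonceInArgs k as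

  record Fact (X : Set) : Set where
    constructor fact
    field
      pred : Pred
      args : Args X (predArity pred)

  substFact : ∀ {X Y} → ((s : Sort) → X → Term Y s) → (ℕ → ℕ) →
              Fact X → Fact Y
  substFact σ ν (fact p as) = fact p (substArgs σ ν as)

  NonceInFact : ∀ {X} → ℕ → Fact X → Set
  NonceInFact k (fact p as) = NonceInArgs k as

  data TFact (X : Set) : Set where
    timeFact : TFact X
    ordFact  : Fact X → TFact X

  GTerm : Sort → Set
  GTerm = Term ⊥

  GFact : Set
  GFact = Fact ⊥

  GSubst : Set
  GSubst = (s : Sort) → ℕ → GTerm s

  TVar : Set
  TVar = ℕ

  TSubst : Set
  TSubst = TVar → ℕ

  -- Configurations: a finite multiset of ground timestamped facts with
  -- exactly one Time@t.  Represented as the global time t together with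
  -- a list (multiset up to ↭) of the other timestamped facts.

  record Config : Set where
    constructor config
    field
      time  : ℕ
      facts : List (GFact × ℕ)
  open Config public

  allFacts : Config → List (TFact ⊥ × ℕ)
  allFacts S = (timeFact , time S) ∷ map (λ p → ordFact (proj₁ p) , proj₂ p) (facts S)

  _⊆ₘ_ : ∀ {A : Set} → List A → List A → Set
  A ⊆ₘ B = ∃[ R ] (B ↭ A ++ R)

  data Rel : Set where
    gt eq : Rel

  data Sign : Set where
    plus minus : Sign

  record Constraint : Set where
    constructor constr
    field
      lhs  : TVar
      rel  : Rel
      rhs  : TVar
      sign : Sign
      off  : ℕ

  -- semantics over ℕ (a - d read as an integer, i.e. moved to the other side)
  Holds : TSubst → Constraint → Set
  Holds τ (constr a gt b plus d)  = τ b + d < τ a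
  Holds τ (constr a gt b minus d) = τ b < τ a + d
  Holds τ (constr a eq b plus d)  = τ a ≡ τ b + d
  Holds τ (constr a eq b minus d) = τ a + d ≡ τ b

  _≥c_ : TVar → TVar → Constraint
  T ≥c T' = constr T gt T' minus 1

  -- Instantaneous rules
  --  Time@T, W₁@T₁,…,W_p@T_p, F₁@T'₁,…,F_n@T'_n | C
  --     → ∃ X⃗. [Time@T, W₁@T₁,…,W_p@T_p, Q₁@(T+d₁),…,Q_m@(T+d_m)]
  -- Precondition terms use variables named by ℕ; postcondition terms
  -- may additionally use the fresh existential variables (Fin nFresh).

  record Rule : Set where
    field
      tT     : TVar
      W      : List (Fact ℕ × TVar)
      F      : List (Fact ℕ × TVar)
      C      : List Constraint
      nFresh : ℕ
      Q      : List (Fact (ℕ ⊎ Fin nFresh) × ℕ)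
  open Rule public

  instPre : GSubst → TSubst → List (Fact ℕ × TVar) → List (GFact × ℕ)
  instPre σ τ = map (λ p → substFact σ (λ n → n) (proj₁ p) , τ (proj₂ p))

  extSubst : ∀ {k} → GSubst → (Fin k → ℕ) → (s : Sort) → ℕ ⊎ Fin k → GTerm s
  extSubst σ ρ s (inj₁ x) = σ s x
  extSubst σ ρ s (inj₂ j) = nonce (ρ j)

  instPost : ∀ {k} → GSubst → (Fin k → ℕ) → ℕ → List (Fact (ℕ ⊎ Fin k) × ℕ) → List (GFact × ℕ)
  instPost σ ρ t = map (λ p → substFact (extSubst σ ρ) (λ n → n) (proj₁ p) , t + proj₂ p)

  Fresh : ∀ {k} → Config → (Fin k → ℕ) → Set
  Fresh S ρ = Injective _≡_ _≡_ ρ × (∀ j → All (λ f → ¬ NonceInFact (ρ j) (proj₁ f)) (facts S))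

  RuleStep : Rule → Config → Config → Set
  RuleStep r S S' =
    Σ GSubst λ σ → Σ TSubst λ τ → Σ (Fin (nFresh r) → ℕ) λ ρ → Σ (List (GFact × ℕ)) λ R →
      (τ (tT r) ≡ time S) ×
      All (Holds τ) (C r) ×
      Fresh S ρ ×
      (facts S ↭ instPre σ τ (W r) ++ instPre σ τ (F r) ++ R) ×
      (S' ≡ config (time S) (instPre σ τ (W r) ++ instPost σ ρ (time S) (Q r) ++ R))

  Tick : Config → Config → Set
  Tick S S' = S' ≡ config (suc (time S)) (facts S)

  System : Set
  System = List Rule

  Applicable : System → Config → Set
  Applicable 𝒯 S = ∃[ r ] (r ∈ 𝒯 × ∃[ S' ] RuleStep r S S')

  LStep : System → Config → Config → Set
  LStep 𝒯 S S' = (∃[ r ] (r ∈ 𝒯 × RuleStep r S S')) ⊎ (Tick S S' × ¬ Applicable 𝒯 S)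

  Balanced : System → Set
  Balanced 𝒯 = All (λ r → length (Q r) ≡ length (F r)) 𝒯

  PTS : System → Set
  PTS 𝒯 = Balanced 𝒯 ×
          All (λ r → Any (λ q → 1 ≤ proj₂ q) (Q r) ×
                     All (λ f → (tT r ≥c proj₂ f) ∈ C r) (F r)) 𝒯

  CritSpec : Set
  CritSpec = List (List (TFact ℕ × TVar) × List Constraint)

  substTFact : GSubst → (ℕ → ℕ) → TFact ℕ → TFact ⊥
  substTFact σ ν timeFact = timeFact
  substTFact σ ν (ordFact f) = ordFact (substFact σ ν f)

  Critical : CritSpec → Config → Set
  Critical 𝒞𝒮 S = ∃[ j ] (j ∈ 𝒞𝒮 ×
    Σ GSubst λ σ → Σ TSubst λ τ → Σ (ℕ → ℕ) λ ν →
      Injective _≡_ _≡_ ν ×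
      (map (λ p → substTFact σ ν (proj₁ p) , τ (proj₂ p)) (proj₁ j) ⊆ₘ allFacts S) ×
      All (Holds τ) (proj₂ j))

  data CReach (𝒯 : System) (𝒞𝒮 : CritSpec) (S₀ : Config) : Config → Set where
    start : ¬ Critical 𝒞𝒮 S₀ → CReach 𝒯 𝒞𝒮 S₀ S₀
    step  : ∀ {S S'} → CReach 𝒯 𝒞𝒮 S₀ S → LStep 𝒯 S S' → ¬ Critical 𝒞𝒮 S' →
            CReach 𝒯 𝒞𝒮 S₀ S'

  InfTrace : System → Config → (ℕ → Config) → Set
  InfTrace 𝒯 S tr = (tr 0 ≡ S) × (∀ i → LStep 𝒯 (tr i) (tr (suc i)))

  Compliant : CritSpec → (ℕ → Config) → Set
  Compliant 𝒞𝒮 tr = ∀ i → ¬ Critical 𝒞𝒮 (tr i)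

  InfiniteTime : (ℕ → Config) → Set
  InfiniteTime tr = ∀ n → ∃[ i ] (n < time (tr i))

  GoodFrom : System → CritSpec → Config → Set
  GoodFrom 𝒯 𝒞𝒮 S = ∃[ tr ] (InfTrace 𝒯 S tr × Compliant 𝒞𝒮 tr × InfiniteTime tr)

  ZProp : System → Config → CritSpec → Set
  ZProp 𝒯 S₀ 𝒞𝒮 = GoodFrom 𝒯 𝒞𝒮 S₀

  PointOfNoReturn : System → CritSpec → Config → Set
  PointOfNoReturn 𝒯 𝒞𝒮 S =
    ¬ Critical 𝒞𝒮 S × (∀ tr → InfTrace 𝒯 S tr → ¬ Compliant 𝒞𝒮 tr)

  VProp : System → Config → CritSpec → Set
  VProp 𝒯 S₀ 𝒞𝒮 = ZProp 𝒯 S₀ 𝒞𝒮 ×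
    (∀ S → CReach 𝒯 𝒞𝒮 S₀ S → ¬ PointOfNoReturn 𝒯 𝒞𝒮 S)

  LProp : System → Config → CritSpec → Set
  LProp 𝒯 S₀ 𝒞𝒮 = ZProp 𝒯 S₀ 𝒞𝒮 ×
    (∀ S → CReach 𝒯 𝒞𝒮 S₀ S → GoodFrom 𝒯 𝒞𝒮 S)

{-# OPTIONS --safe #-}
-- In a progressing system an instantaneous rule consumes only facts that are
-- not in the future and creates as many facts, at least one of them in the
-- future; so it keeps the global time and strictly decreases the number of
-- facts with timestamp at most the global time. Hence no infinite trace can
-- stall time, and a compliant infinite trace is automatically an infinite time
-- trace. So L implies V in any system, and conversely, by excluded middle, a
-- reachable configuration that is not a point-of-no-return has a compliant
-- infinite trace, which is then an infinite time trace.
module Submission where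

open import Defs
open import Level using (0ℓ)
open import Axiom.ExcludedMiddle using (ExcludedMiddle)
open import Axiom.DoubleNegationElimination using (em⇒dne)
open import Function.Bundles using (_⇔_; mk⇔)
open import Data.Nat using (ℕ; zero; suc; _+_; _<_; _≤_; _≤?_; s≤s; z≤n)
open import Data.Nat.Properties
open import Data.Empty using (⊥-elim)
open import Data.Sum using (_⊎_; inj₁; inj₂)
open import Data.Product using (∃-syntax; _×_; _,_; proj₁; proj₂)
open import Data.List using (List; _++_; length; filter)
open import Data.List.Properties using (length-++; length-map; filter-++; filter-all; filter-notAll)
open import Data.List.Relation.Unary.All as All using (All)
open import Data.List.Relation.Unary.Any as Any using (Any)
import Data.List.Relation.Unary.All.Properties as All
import Data.List.Relation.Unary.Any.Properties as Any
open import Data.List.Membership.Propositional using (_∈_)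
open import Data.List.Relation.Binary.Permutation.Propositional using (_↭_)
open import Data.List.Relation.Binary.Permutation.Propositional.Properties
  using (↭-length; filter-↭)
open import Relation.Binary.PropositionalEquality using (_≡_; refl; cong; subst)
open import Relation.Nullary using (¬_)
open import Relation.Unary using (Pred; Decidable; ∁)

module _ {A : Set} {P : Pred A 0ℓ} (P? : Decidable P) where

  length-filter-++ : ∀ xs ys →
    length (filter P? (xs ++ ys)) ≡ length (filter P? xs) + length (filter P? ys)
  length-filter-++ xs ys rewrite filter-++ P? xs ys = length-++ (filter P? xs)

  length-filter-↭ : ∀ {xs ys} → xs ↭ ys → length (filter P? xs) ≡ length (filter P? ys)
  length-filter-↭ xs↭ys = ↭-length (filter-↭ P? xs↭ys)

  length-filter-replace-< : ∀ zs ws {xs ys} → length ys ≡ length xs →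
    All P xs → Any (∁ P) ys →
    length (filter P? (zs ++ ys ++ ws)) < length (filter P? (zs ++ xs ++ ws))
  length-filter-replace-< zs ws {xs} {ys} |ys|≡|xs| allP anyP = begin-strict
    length (filter P? (zs ++ ys ++ ws))
      ≡⟨ length-filter-++ zs (ys ++ ws) ⟩
    ∣ zs ∣ + length (filter P? (ys ++ ws))
      ≡⟨ cong (∣ zs ∣ +_) (length-filter-++ ys ws) ⟩
    ∣ zs ∣ + (∣ ys ∣ + ∣ ws ∣)
      <⟨ +-monoʳ-< ∣ zs ∣ (+-monoˡ-< ∣ ws ∣ ys-loses) ⟩
    ∣ zs ∣ + (length xs + ∣ ws ∣)
      ≡⟨ cong (λ n → ∣ zs ∣ + (n + ∣ ws ∣)) (cong length (filter-all P? allP)) ⟨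
    ∣ zs ∣ + (∣ xs ∣ + ∣ ws ∣)
      ≡⟨ cong (∣ zs ∣ +_) (length-filter-++ xs ws) ⟨
    ∣ zs ∣ + length (filter P? (xs ++ ws))
      ≡⟨ length-filter-++ zs (xs ++ ws) ⟨
    length (filter P? (zs ++ xs ++ ws)) ∎
    where
      open ≤-Reasoning
      ∣_∣ : List A → ℕ
      ∣ us ∣ = length (filter P? us)
      ys-loses : ∣ ys ∣ < length xs
      ys-loses = subst (∣ ys ∣ <_) |ys|≡|xs| (filter-notAll P? ys anyP)

module LexicographicProgress
  (f g : ℕ → ℕ)
  (progress : ∀ i → f i < f (suc i) ⊎ (f (suc i) ≡ f i × g (suc i) < g i))
  where

  eventually-increases : ∀ i → ∃[ j ] f i < f j
  eventually-increases i₀ = go (g i₀) i₀ ≤-refl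
    where
      go : ∀ m i → g i ≤ m → ∃[ j ] f i < f j
      go m i gᵢ≤m with progress i
      ... | inj₁ fᵢ<fᵢ₊₁ = suc i , fᵢ<fᵢ₊₁
      go zero    i gᵢ≤0   | inj₂ (_ , gᵢ₊₁<gᵢ) =
        ⊥-elim (n≮0 (≤-trans gᵢ₊₁<gᵢ gᵢ≤0))
      go (suc m) i gᵢ≤1+m | inj₂ (fᵢ₊₁≡fᵢ , gᵢ₊₁<gᵢ)
        with j , fᵢ₊₁<fⱼ ← go m (suc i) (≤-pred (≤-trans gᵢ₊₁<gᵢ gᵢ≤1+m)) =
        j , subst (_< f j) fᵢ₊₁≡fᵢ fᵢ₊₁<fⱼ

  unbounded : ∀ n → ∃[ i ] n < f i
  unbounded zero with j , f₀<fⱼ ← eventually-increases 0 = j , ≤-<-trans z≤n f₀<fⱼ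
  unbounded (suc n)
    with i , n<fᵢ ← unbounded n
    with j , fᵢ<fⱼ ← eventually-increases i =
    j , <-≤-trans (s≤s n<fᵢ) fᵢ<fⱼ

module _ (𝒜 : Alphabet) where
  open MSR 𝒜 hiding (subst)

  presentCount : Config → ℕ
  presentCount S = length (filter (λ p → proj₂ p ≤? time S) (facts S))

  ≥c-sound : ∀ τ T T' → Holds τ (T ≥c T') → τ T' ≤ τ T
  ≥c-sound τ T T' h = m<1+n⇒m≤n (subst (τ T' <_) (+-comm (τ T) 1) h)

  ruleStep-time : ∀ {r S S'} → RuleStep r S S' → time S' ≡ time S
  ruleStep-time (_ , _ , _ , _ , _ , _ , _ , _ , refl) = refl

  ruleStep-presentCount-< : ∀ {𝒯 r S S'} → PTS 𝒯 → r ∈ 𝒯 → RuleStep r S S' →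
    presentCount S' < presentCount S
  ruleStep-presentCount-< {r = r} {S} (balanced , progressing) r∈𝒯
    (σ , τ , ρ , R , τT≡t , constraints , _ , facts↭ , refl) = begin-strict
      length (filter NotFuture? (Ws ++ Qs ++ R))
        <⟨ length-filter-replace-< NotFuture? Ws R
             same-length consumed-not-future created-future ⟩
      length (filter NotFuture? (Ws ++ Fs ++ R))
        ≡⟨ length-filter-↭ NotFuture? facts↭ ⟨
      presentCount S ∎
    where
      open ≤-Reasoning
      t = time S
      NotFuture? = λ (p : GFact × ℕ) → proj₂ p ≤? t
      Ws = instPre σ τ (W r)
      Fs = instPre σ τ (F r)
      Qs = instPost σ ρ t (Q r)
      same-length : length Qs ≡ length Fs
      same-length = begin-equality
        length Qs    ≡⟨ length-map _ (Q r) ⟩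
        length (Q r) ≡⟨ All.lookup balanced r∈𝒯 ⟩
        length (F r) ≡⟨ length-map _ (F r) ⟨
        length Fs    ∎
      consumed-not-future : All (λ p → proj₂ p ≤ t) Fs
      consumed-not-future = All.gmap⁺
        (λ {f} c∈C → subst (τ (proj₂ f) ≤_) τT≡t
          (≥c-sound τ (tT r) (proj₂ f) (All.lookup constraints c∈C)))
        (proj₂ (All.lookup progressing r∈𝒯))
      created-future : Any (λ p → ¬ proj₂ p ≤ t) Qs
      created-future = Any.map⁺ (Any.map (λ 1≤d → <⇒≱ (m<m+n t 1≤d))
        (proj₁ (All.lookup progressing r∈𝒯)))

  lStep-progress : ∀ {𝒯 S S'} → PTS 𝒯 → LStep 𝒯 S S' →
    time S < time S' ⊎ (time S' ≡ time S × presentCount S' < presentCount S)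
  lStep-progress pts (inj₁ (r , r∈𝒯 , ruleStep)) =
    inj₂ (ruleStep-time {r} ruleStep , ruleStep-presentCount-< pts r∈𝒯 ruleStep)
  lStep-progress pts (inj₂ (refl , _)) = inj₁ ≤-refl

  infTrace⇒infiniteTime : ∀ {𝒯 S tr} → PTS 𝒯 → InfTrace 𝒯 S tr → InfiniteTime tr
  infTrace⇒infiniteTime {tr = tr} pts (_ , steps) =
    LexicographicProgress.unbounded (λ i → time (tr i)) (λ i → presentCount (tr i))
      (λ i → lStep-progress pts (steps i))

  cReach⇒¬critical : ∀ {𝒯 𝒞𝒮 S₀ S} → CReach 𝒯 𝒞𝒮 S₀ S → ¬ Critical 𝒞𝒮 S
  cReach⇒¬critical (start ¬critical)    = ¬critical
  cReach⇒¬critical (step _ _ ¬critical) = ¬critical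

  compliantTrace⇒goodFrom : ∀ {𝒯 𝒞𝒮 S} → PTS 𝒯 →
    ∃[ tr ] (InfTrace 𝒯 S tr × Compliant 𝒞𝒮 tr) → GoodFrom 𝒯 𝒞𝒮 S
  compliantTrace⇒goodFrom pts (tr , trace , compliant) =
    tr , trace , compliant , infTrace⇒infiniteTime pts trace

  goodFrom⇒¬pointOfNoReturn : ∀ {𝒯 𝒞𝒮 S} →
    GoodFrom 𝒯 𝒞𝒮 S → ¬ PointOfNoReturn 𝒯 𝒞𝒮 S
  goodFrom⇒¬pointOfNoReturn (tr , trace , compliant , _) (_ , noneCompliant) =
    noneCompliant tr trace compliant

  ¬pointOfNoReturn⇒goodFrom : ∀ {𝒯 𝒞𝒮 S} → ExcludedMiddle 0ℓ → PTS 𝒯 →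
    ¬ Critical 𝒞𝒮 S → ¬ PointOfNoReturn 𝒯 𝒞𝒮 S → GoodFrom 𝒯 𝒞𝒮 S
  ¬pointOfNoReturn⇒goodFrom em pts ¬critical ¬pnr =
    compliantTrace⇒goodFrom pts (em⇒dne em λ none →
      ¬pnr (¬critical , λ tr trace compliant → none (tr , trace , compliant)))

proposition8 : ExcludedMiddle 0ℓ → (𝒜 : Alphabet) → (𝒯 : MSR.System 𝒜) → MSR.PTS 𝒜 𝒯 →
    (S₀ : MSR.Config 𝒜) → (𝒞𝒮 : MSR.CritSpec 𝒜) →
    MSR.LProp 𝒜 𝒯 S₀ 𝒞𝒮 ⇔ MSR.VProp 𝒜 𝒯 S₀ 𝒞𝒮
proposition8 em 𝒜 𝒯 pts S₀ 𝒞𝒮 = mk⇔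
  (λ (z , good) → z , λ S reach → goodFrom⇒¬pointOfNoReturn 𝒜 (good S reach))
  (λ (z , viable) → z , λ S reach →
    ¬pointOfNoReturn⇒goodFrom 𝒜 em pts (cReach⇒¬critical 𝒜 reach) (viable S reach))
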